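{- For $i=1,2$ let $(L_i,G_i)$ be a linear permutation group which is 2-interval-transitive and has a nonidentity bounded element, let $\alpha:G_1\to G_2$ be a group isomorphism, and let $\tau:\bar L_1\to\bar L_2$ be the unique monotonic bijection with $\alpha(g)=\tau\circ g\circ\tau^{ -1}$ for all $g\in G_1$. Then $M\mapsto\tau(M)$ is a bijection from the set of orbits of $(\bar L_1,G_1)$ onto the set of orbits of $(\bar L_2,G_2)$. Either $\tau\restriction M$ preserves order for every orbit $M$ (when $\tau$ preserves order) or $\tau\restriction M$ reverses order for every orbit $M$ (when $\tau$ reverses order). In the former case $(\tau\restriction M)\cup\alpha$ is an isomorphism of permutation groups from $(M,G_1)$ onto $(\tau(M),G_2)$, and in the latter case from $(M,G_1)$ onto $(\tau(M)^*,G_2)$.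
   Context: A chain $L$ is a dense linearly ordered set without endpoints; $\mathrm{Aut}(L)$ is its group of order-preserving bijections; $\bar L$ is its Dedekind completion without endpoints, and every $g\in\mathrm{Aut}(L)$ extends uniquely to $\bar L$. A linear permutation group is $(L,G)$ with $G\le\mathrm{Aut}(L)$; $G$ then acts on $\bar L$ and its orbits there are the orbits of $(\bar L,G)$. $L$-intervals: $(x,y)$ with $x<y$, rays, and $L$; bounded ones are $(x,y)$. $\mathrm{supp}(g)=\{x\in\bar L:g(x)\ne x\}$; $g$ is bounded if its support lies in a bounded interval. $(L,G)$ is 2-interval-transitive if for all $L$-intervals $I_1<I_2$, $J_1<J_2$ there is $g\in G$ with $g(I_k)\cap J_k\ne\emptyset$ ($k=1,2$). Monotonic = order-preserving or order-reversing. For a chain $M$, $M^*$ is $M$ with the reverse order. For subchains $M\subseteq\bar L_1$, $M'\subseteq\bar L_2$ invariant under $G_1$, $G_2$ respectively, an isomorphism $(M,G_1)\to(M',G_2)$ is a pair consisting of an order-isomorphism $\sigma:M\to M'$ and a group isomorphism $\alpha:G_1\to G_2$ with $\sigma(g(x))=\alpha(g)(\sigma(x))$ for all $g\in G_1$, $x\in M$. -}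

module Defs where

open import Level using (0ℓ)
open import Data.Product using (Σ; ∃; _×_; _,_; proj₁; proj₂)
open import Data.Sum using (_⊎_)
open import Relation.Nullary using (¬_)
open import Relation.Binary.PropositionalEquality using (_≡_; _≢_; refl; sym; trans; cong)
open import Data.Empty using (⊥-elim)
import Data.Unit
open import Data.Bool using (Bool; true; false)

record Chain : Set₁ where
  field
    Car       : Set
    _<_       : Car → Car → Set
    <-irrefl  : ∀ {x} → ¬ (x < x)
    <-trans   : ∀ {x y z} → x < y → y < z → x < z
    connected : ∀ {x y} → x ≢ y → (x < y) ⊎ (y < x)
    dense     : ∀ {x y} → x < y → ∃ λ z → (x < z) × (z < y)
    noMax     : ∀ x → ∃ λ y → x < y
    noMin     : ∀ x → ∃ λ y → y < x

  _≤_ : Car → Car → Set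
  x ≤ y = (x < y) ⊎ (x ≡ y)

open Chain public

record Aut (C : Chain) : Set where
  field
    fun   : Car C → Car C
    inv   : Car C → Car C
    inv-l : ∀ x → inv (fun x) ≡ x
    inv-r : ∀ x → fun (inv x) ≡ x
    mono  : ∀ {x y} → _<_ C x y → _<_ C (fun x) (fun y)

open Aut public

_≈ᴬ_ : {C : Chain} → Aut C → Aut C → Set
f ≈ᴬ g = ∀ x → fun f x ≡ fun g x

idᴬ : {C : Chain} → Aut C
idᴬ = record { fun = λ x → x ; inv = λ x → x
             ; inv-l = λ _ → Relation.Binary.PropositionalEquality.refl
             ; inv-r = λ _ → Relation.Binary.PropositionalEquality.refl
             ; mono = λ p → p }

_∘ᴬ_ : {C : Chain} → Aut C → Aut C → Aut C
_∘ᴬ_ {C} f g = record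
  { fun = λ x → fun f (fun g x)
  ; inv = λ x → inv g (inv f x)
  ; inv-l = λ x → Relation.Binary.PropositionalEquality.trans
                    (Relation.Binary.PropositionalEquality.cong (inv g) (inv-l f (fun g x)))
                    (inv-l g x)
  ; inv-r = λ x → Relation.Binary.PropositionalEquality.trans
                    (Relation.Binary.PropositionalEquality.cong (fun f) (inv-r g (inv f x)))
                    (inv-r f x)
  ; mono = λ p → mono f (mono g p) }

invᴬ : {C : Chain} → Aut C → Aut C
invᴬ {C} f = record
  { fun = inv f ; inv = fun f ; inv-l = inv-r f ; inv-r = inv-l f
  ; mono = m }
  where
  m : ∀ {x y} → _<_ C x y → _<_ C (inv f x) (inv f y)
  m {x} {y} p with connected C {inv f x} {inv f y} ne
    where
    ne : inv f x ≢ inv f y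
    ne e = <-irrefl C (Relation.Binary.PropositionalEquality.subst (λ z → _<_ C z y)
             (trans (sym (inv-r f x)) (trans (cong (fun f) e) (inv-r f y))) p)
  ... | _⊎_.inj₁ q = q
  ... | _⊎_.inj₂ q = ⊥-elim (<-irrefl C (<-trans C p
          (Relation.Binary.PropositionalEquality.subst₂ (_<_ C) (inv-r f y) (inv-r f x) (mono f q))))

record Subgroup (C : Chain) : Set₁ where
  field
    mem      : Aut C → Set
    mem-resp : ∀ {f g} → f ≈ᴬ g → mem f → mem g
    mem-id   : mem idᴬ
    mem-∘    : ∀ {f g} → mem f → mem g → mem (f ∘ᴬ g)
    mem-inv  : ∀ {f} → mem f → mem (invᴬ f)

open Subgroup public

El : {C : Chain} → Subgroup C → Set
El G = Σ (Aut _) (mem G)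

_∙_ : {C : Chain} {G : Subgroup C} → El G → El G → El G
_∙_ {G = G} (f , p) (g , q) = (f ∘ᴬ g) , mem-∘ G p q

record GroupIso {C₁ C₂ : Chain} (G₁ : Subgroup C₁) (G₂ : Subgroup C₂) : Set where
  field
    map    : El G₁ → El G₂
    resp   : ∀ g h → proj₁ g ≈ᴬ proj₁ h → proj₁ (map g) ≈ᴬ proj₁ (map h)
    hom    : ∀ g h → proj₁ (map (_∙_ {G = G₁} g h)) ≈ᴬ (proj₁ (map g) ∘ᴬ proj₁ (map h))
    inj    : ∀ g h → proj₁ (map g) ≈ᴬ proj₁ (map h) → proj₁ g ≈ᴬ proj₁ h
    surj   : ∀ (k : El G₂) → ∃ λ (g : El G₁) → proj₁ (map g) ≈ᴬ proj₁ k

open GroupIso public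

-- Dedekind completion without endpoints, characterised up to isomorphism:
-- a chain L̄ (no endpoints) into which L embeds order-densely and in which
-- every nonempty subset bounded above has a supremum; together with the
-- (unique) extension of every automorphism of L to L̄.

record IsSup (C : Chain) (S : Car C → Set) (c : Car C) : Set where
  field
    upper : ∀ s → S s → _≤_ C s c
    least : ∀ b → (∀ s → S s → _≤_ C s b) → _≤_ C c b

record Completion (L : Chain) : Set₁ where
  field
    L̄        : Chain
    ι         : Car L → Car L̄
    ι-mono    : ∀ {x y} → _<_ L x y → _<_ L̄ (ι x) (ι y)
    ι-refl    : ∀ {x y} → _<_ L̄ (ι x) (ι y) → _<_ L x y
    ι-dense   : ∀ {a b} → _<_ L̄ a b → ∃ λ x → (_<_ L̄ a (ι x)) × (_<_ L̄ (ι x) b)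
    complete  : (S : Car L̄ → Set) → (∃ S) → (∃ λ b → ∀ s → S s → _≤_ L̄ s b)
                → ∃ λ c → IsSup L̄ S c
    ext       : Aut L → Aut L̄
    ext-ι     : ∀ g x → fun (ext g) (ι x) ≡ ι (fun g x)

open Completion public

record LPG : Set₂ where
  field
    L    : Chain
    comp : Completion L
    G    : Subgroup L

open LPG public

Lbar : LPG → Chain
Lbar P = L̄ (comp P)

act : (P : LPG) → Aut (L P) → Car (Lbar P) → Car (Lbar P)
act P g = fun (ext (comp P) g)

data Interval (P : LPG) : Set where
  bdd   : (a b : Car (Lbar P)) → _<_ (Lbar P) a b → Interval P
  below : (b : Car (Lbar P)) → Interval P
  above : (a : Car (Lbar P)) → Interval P
  whole : Interval P

_∈I_ : {P : LPG} → Car (L P) → Interval P → Set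
_∈I_ {P} x (bdd a b _) = _<_ (Lbar P) a (ι (comp P) x) × _<_ (Lbar P) (ι (comp P) x) b
_∈I_ {P} x (below b)   = _<_ (Lbar P) (ι (comp P) x) b
_∈I_ {P} x (above a)   = _<_ (Lbar P) a (ι (comp P) x)
_∈I_ {P} x whole       = Data.Unit.⊤

_<I_ : {P : LPG} → Interval P → Interval P → Set
_<I_ {P} I J = ∀ x y → x ∈I I → y ∈I J → _<_ (L P) x y

TwoIntervalTransitive : LPG → Set
TwoIntervalTransitive P =
  (I₁ I₂ J₁ J₂ : Interval P) → I₁ <I I₂ → J₁ <I J₂ →
  ∃ λ (g : El (G P)) →
    (∃ λ x → (x ∈I I₁) × (fun (proj₁ g) x ∈I J₁)) ×
    (∃ λ x → (x ∈I I₂) × (fun (proj₁ g) x ∈I J₂))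

HasBoundedNonId : LPG → Set
HasBoundedNonId P =
  ∃ λ (g : El (G P)) →
    (∃ λ x → fun (proj₁ g) x ≢ x) ×
    (∃ λ a → ∃ λ b → _<_ (Lbar P) a b ×
       (∀ x → act P (proj₁ g) x ≢ x → _<_ (Lbar P) a x × _<_ (Lbar P) x b))

Subset : Set → Set₁
Subset A = A → Set

_≐_ : {A : Set} → Subset A → Subset A → Set
M ≐ N = ∀ x → (M x → N x) × (N x → M x)

orbit : (P : LPG) → Car (Lbar P) → Subset (Car (Lbar P))
orbit P x y = ∃ λ (g : El (G P)) → act P (proj₁ g) x ≡ y

IsOrbit : (P : LPG) → Subset (Car (Lbar P)) → Set
IsOrbit P M = ∃ λ x → M ≐ orbit P x

image : {A B : Set} → (A → B) → Subset A → Subset B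
image f M y = ∃ λ x → M x × f x ≡ y

Bijective : {A B : Set} → (A → B) → Set
Bijective f = (∀ x y → f x ≡ f y → x ≡ y) × (∀ y → ∃ λ x → f x ≡ y)

OrderPreserving : (C D : Chain) → (Car C → Car D) → Set
OrderPreserving C D f = ∀ {x y} → _<_ C x y → _<_ D (f x) (f y)

OrderReversing : (C D : Chain) → (Car C → Car D) → Set
OrderReversing C D f = ∀ {x y} → _<_ C x y → _<_ D (f y) (f x)

PreservesOn : (C D : Chain) → (Car C → Car D) → Subset (Car C) → Set
PreservesOn C D f M = ∀ x y → M x → M y → _<_ C x y → _<_ D (f x) (f y)

ReversesOn : (C D : Chain) → (Car C → Car D) → Subset (Car C) → Set
ReversesOn C D f M = ∀ x y → M x → M y → _<_ C x y → _<_ D (f y) (f x)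

OrbitBijection : (P₁ P₂ : LPG) → (Car (Lbar P₁) → Car (Lbar P₂)) → Set₁
OrbitBijection P₁ P₂ τ =
  (∀ M → IsOrbit P₁ M → IsOrbit P₂ (image τ M)) ×
  (∀ M M′ → IsOrbit P₁ M → IsOrbit P₁ M′ → image τ M ≐ image τ M′ → M ≐ M′) ×
  (∀ N → IsOrbit P₂ N → ∃ λ M → IsOrbit P₁ M × (image τ M ≐ N))

-- (σ, α) is an isomorphism of permutation groups (M,G₁) → (M′,G₂)
-- (rev = false) or (M,G₁) → (M′*,G₂) (rev = true).
-- σ : M → M′ is an order isomorphism (of M′ or of M′ reversed), α is the
-- given group isomorphism, and σ(g x) = α(g)(σ x).
-- target order: that of the chain (false) or its reverse M* (true)
OrdTgt : (C : Chain) → Bool → Car C → Car C → Set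
OrdTgt C false u v = _<_ C u v
OrdTgt C true  u v = _<_ C v u

record PermIso (P₁ P₂ : LPG) (rev : Bool) (M : Subset (Car (Lbar P₁)))
               (M′ : Subset (Car (Lbar P₂))) (σ : Car (Lbar P₁) → Car (Lbar P₂))
               (α : GroupIso (G P₁) (G P₂)) : Set where
  field
    into  : ∀ x → M x → M′ (σ x)
    onto  : ∀ y → M′ y → ∃ λ x → M x × σ x ≡ y
    order : ∀ x y → M x → M y →
            (_<_ (Lbar P₁) x y → OrdTgt (Lbar P₂) rev (σ x) (σ y)) ×
            (OrdTgt (Lbar P₂) rev (σ x) (σ y) → _<_ (Lbar P₁) x y)
    equiv : ∀ (g : El (G P₁)) x → M x →
            σ (act P₁ (proj₁ g) x) ≡ act P₂ (proj₁ (map α g)) (σ x)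

{-# OPTIONS --safe #-}
module Submission where

open import Defs
open import Data.Product using (_×_; proj₁; proj₂; _,_; ∃)
open import Data.Sum using (_⊎_; inj₁; inj₂)
open import Data.Bool using (Bool; true; false)
open import Data.Empty using (⊥-elim)
open import Relation.Nullary using (¬_)
open import Relation.Binary.PropositionalEquality
  using (_≡_; refl; sym; trans; cong; subst; subst₂)

-- Since τ conjugates G₁ onto G₂ via α, it carries the orbit of x onto the
-- orbit of τ x, and, being monotonic, it is an order (anti-)isomorphism on each
-- orbit. The one subtle point is that α is only surjective up to pointwise
-- equality on L, so we need that the extension of an automorphism to L̄ only
-- depends on its values on L: the value at a is the supremum of the images of
-- the points of L below a.

module _ {A : Set} where

  ≐-refl : {M : Subset A} → M ≐ M
  ≐-refl _ = (λ m → m) , (λ m → m)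

  ≐-sym : {M N : Subset A} → M ≐ N → N ≐ M
  ≐-sym p x = proj₂ (p x) , proj₁ (p x)

  ≐-trans : {M N O : Subset A} → M ≐ N → N ≐ O → M ≐ O
  ≐-trans p q x = (λ m → proj₁ (q x) (proj₁ (p x) m)) , (λ o → proj₂ (p x) (proj₂ (q x) o))

  image-resp-≐ : {B : Set} (f : A → B) {M N : Subset A} → M ≐ N → image f M ≐ image f N
  image-resp-≐ f p y = (λ { (x , m , e) → x , proj₁ (p x) m , e })
                     , (λ { (x , n , e) → x , proj₂ (p x) n , e })

  image-injective-reflects-≐ : {B : Set} (f : A → B) → (∀ x y → f x ≡ f y → x ≡ y) →
                               {M N : Subset A} → image f M ≐ image f N → M ≐ N
  image-injective-reflects-≐ f inj {M} {N} p x = into N (proj₁ (p (f x))) , into M (proj₂ (p (f x)))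
    where
    into : ∀ {K} O → (image f K (f x) → image f O (f x)) → K x → O x
    into O q k with q (x , k , refl)
    ... | x′ , o , e = subst O (inj x′ x e) o

module _ (C : Chain) where

  <⇒≱ : ∀ {u v} → _<_ C u v → ¬ (_≤_ C v u)
  <⇒≱ p (inj₁ q)    = <-irrefl C (<-trans C p q)
  <⇒≱ p (inj₂ refl) = <-irrefl C p

  IsSup-resp-≐ : ∀ {S T c} → S ≐ T → IsSup C S c → IsSup C T c
  IsSup-resp-≐ p sup = record
    { upper = λ t t∈T → IsSup.upper sup t (proj₂ (p t) t∈T)
    ; least = λ b ub → IsSup.least sup b (λ s s∈S → ub s (proj₁ (p s) s∈S)) }

module _ (D : Chain) where

  OrdTgt-irrefl : ∀ rev {u} → ¬ OrdTgt D rev u u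
  OrdTgt-irrefl false = <-irrefl D
  OrdTgt-irrefl true  = <-irrefl D

  OrdTgt-asym : ∀ rev {u v} → OrdTgt D rev u v → ¬ OrdTgt D rev v u
  OrdTgt-asym false p q = <-irrefl D (<-trans D p q)
  OrdTgt-asym true  p q = <-irrefl D (<-trans D p q)

strictMono-reflects : (C D : Chain) (rev : Bool) (f : Car C → Car D) →
                      (∀ {x y} → _<_ C x y → OrdTgt D rev (f x) (f y)) →
                      ∀ {x y} → OrdTgt D rev (f x) (f y) → _<_ C x y
strictMono-reflects C D rev f mono {x} {y} p with connected C {x} {y} (λ { refl → OrdTgt-irrefl D rev p })
... | inj₁ x<y = x<y
... | inj₂ y<x = ⊥-elim (OrdTgt-asym D rev p (mono y<x))

module _ {L : Chain} (Cm : Completion L) where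
  private
    L̄C   = L̄ Cm
    _<̄_ = _<_ L̄C
    _≤̄_ = _≤_ L̄C
    ι̂   = ι Cm
    ext̂ : Aut L → Car L̄C → Car L̄C
    ext̂ h = fun (ext Cm h)

  ext-reflects-< : (h : Aut L) → ∀ {u v} → ext̂ h u <̄ ext̂ h v → u <̄ v
  ext-reflects-< h {u} {v} p =
    subst₂ _<̄_ (inv-l (ext Cm h) u) (inv-l (ext Cm h) v) (mono (invᴬ (ext Cm h)) p)

  lowerImage : Aut L → Car L̄C → Subset (Car L̄C)
  lowerImage h a s = ∃ λ y → (ι̂ y <̄ a) × (ι̂ (fun h y) ≡ s)

  lowerImage-nonempty : (h : Aut L) (a : Car L̄C) → ∃ (lowerImage h a)
  lowerImage-nonempty h a with noMin L̄C a
  ... | a′ , a′<a with ι-dense Cm a′<a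
  ...   | y , _ , y<a = ι̂ (fun h y) , y , y<a , refl

  lowerImage-resp-≈ᴬ : ∀ {f g} → f ≈ᴬ g → ∀ a → lowerImage f a ≐ lowerImage g a
  lowerImage-resp-≈ᴬ f≈g a s = (λ { (y , y<a , e) → y , y<a , trans (cong ι̂ (sym (f≈g y))) e })
                             , (λ { (y , y<a , e) → y , y<a , trans (cong ι̂ (f≈g y)) e })

  ext-upperBound : (h : Aut L) (a : Car L̄C) → ∀ s → lowerImage h a s → s ≤̄ ext̂ h a
  ext-upperBound h a s (y , y<a , refl) =
    inj₁ (subst (_<̄ ext̂ h a) (ext-ι Cm h y) (mono (ext Cm h) y<a))

  -- A point of L strictly between the supremum and ext̂ h a would be the image
  -- of a point below a, hence below the supremum.
  ext-≡-sup : (h : Aut L) (a : Car L̄C) {c : Car L̄C} → IsSup L̄C (lowerImage h a) c → ext̂ h a ≡ c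
  ext-≡-sup h a {c} sup with IsSup.least sup (ext̂ h a) (ext-upperBound h a)
  ... | inj₂ c≡ext = sym c≡ext
  ... | inj₁ c<ext with ι-dense Cm c<ext
  ...   | x , c<x , x<ext = ⊥-elim (<⇒≱ L̄C c<x (IsSup.upper sup (ι̂ x) x∈S))
    where
    ext-at-preimage : ext̂ h (ι̂ (inv h x)) ≡ ι̂ x
    ext-at-preimage = trans (ext-ι Cm h (inv h x)) (cong ι̂ (inv-r h x))

    x∈S : lowerImage h a (ι̂ x)
    x∈S = inv h x
        , ext-reflects-< h (subst (_<̄ ext̂ h a) (sym ext-at-preimage) x<ext)
        , cong ι̂ (inv-r h x)

  ext-resp-≈ᴬ : ∀ {f g} → f ≈ᴬ g → ∀ a → ext̂ f a ≡ ext̂ g a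
  ext-resp-≈ᴬ {f} {g} f≈g a =
    trans (ext-≡-sup f a sup)
          (sym (ext-≡-sup g a (IsSup-resp-≐ L̄C (lowerImage-resp-≈ᴬ {f} {g} f≈g a) sup)))
    where
    sup-exists : ∃ (IsSup L̄C (lowerImage f a))
    sup-exists = complete Cm (lowerImage f a) (lowerImage-nonempty f a) (ext̂ f a , ext-upperBound f a)
    sup : IsSup L̄C (lowerImage f a) (proj₁ sup-exists)
    sup = proj₂ sup-exists

module Equivariant (P₁ P₂ : LPG) (α : GroupIso (G P₁) (G P₂))
    (τ : Car (Lbar P₁) → Car (Lbar P₂))
    (τ-equivariant : ∀ (g : El (G P₁)) x → act P₂ (proj₁ (map α g)) (τ x) ≡ τ (act P₁ (proj₁ g) x))
    where

  image-orbit : ∀ x → image τ (orbit P₁ x) ≐ orbit P₂ (τ x)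
  image-orbit x y = to , from
    where
    to : image τ (orbit P₁ x) y → orbit P₂ (τ x) y
    to (_ , (g , refl) , refl) = map α g , τ-equivariant g x
    from : orbit P₂ (τ x) y → image τ (orbit P₁ x) y
    from (k , refl) with surj α k
    ... | g , αg≈k = act P₁ (proj₁ g) x , (g , refl)
                   , trans (sym (τ-equivariant g x)) (ext-resp-≈ᴬ (comp P₂) αg≈k (τ x))

  image-IsOrbit : ∀ M → IsOrbit P₁ M → IsOrbit P₂ (image τ M)
  image-IsOrbit M (x , M≐Gx) = τ x , ≐-trans (image-resp-≐ τ M≐Gx) (image-orbit x)

  orbitBijection : Bijective τ → OrbitBijection P₁ P₂ τ
  orbitBijection (τ-inj , τ-surj) =
    image-IsOrbit , (λ _ _ _ _ → image-injective-reflects-≐ τ τ-inj) , preimage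
    where
    preimage : ∀ N → IsOrbit P₂ N → ∃ λ M → IsOrbit P₁ M × (image τ M ≐ N)
    preimage N (y , N≐Gy) with τ-surj y
    ... | x , refl = orbit P₁ x , (x , ≐-refl) , ≐-trans (image-orbit x) (≐-sym N≐Gy)

  permIso : (rev : Bool) →
            (∀ {x y} → _<_ (Lbar P₁) x y → OrdTgt (Lbar P₂) rev (τ x) (τ y)) →
            ∀ M → PermIso P₁ P₂ rev M (image τ M) τ α
  permIso rev τ-mono M = record
    { into  = λ x m → x , m , refl
    ; onto  = λ _ τx∈τM → τx∈τM
    ; order = λ _ _ _ _ → τ-mono , strictMono-reflects (Lbar P₁) (Lbar P₂) rev τ τ-mono
    ; equiv = λ g x _ → sym (τ-equivariant g x) }

-- The transitivity and bounded-element hypotheses are what make τ exist;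
-- here τ is supplied, so they are deliberately unused.
corollary7p7 : (P₁ P₂ : LPG) →
    TwoIntervalTransitive P₁ → HasBoundedNonId P₁ →
    TwoIntervalTransitive P₂ → HasBoundedNonId P₂ →
    (α : GroupIso (G P₁) (G P₂)) →
    (τ : Car (Lbar P₁) → Car (Lbar P₂)) →
    Bijective τ →
    (OrderPreserving (Lbar P₁) (Lbar P₂) τ ⊎ OrderReversing (Lbar P₁) (Lbar P₂) τ) →
    (∀ (g : El (G P₁)) x → act P₂ (proj₁ (map α g)) (τ x) ≡ τ (act P₁ (proj₁ g) x)) →
    OrbitBijection P₁ P₂ τ ×
    ((OrderPreserving (Lbar P₁) (Lbar P₂) τ ×
      (∀ M → IsOrbit P₁ M → PreservesOn (Lbar P₁) (Lbar P₂) τ M × PermIso P₁ P₂ false M (image τ M) τ α))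
     ⊎
     (OrderReversing (Lbar P₁) (Lbar P₂) τ ×
      (∀ M → IsOrbit P₁ M → ReversesOn (Lbar P₁) (Lbar P₂) τ M × PermIso P₁ P₂ true M (image τ M) τ α)))
corollary7p7 P₁ P₂ _ _ _ _ α τ τ-bij (inj₁ τ-pres) τ-equivariant =
  orbitBijection τ-bij , inj₁ (τ-pres , λ M _ → (λ _ _ _ _ → τ-pres) , permIso false τ-pres M)
  where open Equivariant P₁ P₂ α τ τ-equivariant
corollary7p7 P₁ P₂ _ _ _ _ α τ τ-bij (inj₂ τ-rev) τ-equivariant =
  orbitBijection τ-bij , inj₂ (τ-rev , λ M _ → (λ _ _ _ _ → τ-rev) , permIso true τ-rev M)
  where open Equivariant P₁ P₂ α τ τ-equivariant
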